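{- Let $P$ be a finite set of points of the integer grid, and consider an ST-tree for $P$. If a node of height $h$ of the ST-tree is full, then its rectangle intersects at least $2^h$ points of $P$.
   Context: An ST-tree is a rooted tree in which every node has an associated axis-parallel rectangle in the integer grid $\mathbb{Z}^2$ (the $x$-axis represents memory addresses, the $y$-axis time, increasing upward). A rectangle is either closed (four-sided) or open (three-sided, unbounded in the upward direction). A node of height $h$ (leaves have height $0$) has a rectangle of width $2^h$; hence all leaves are at the same depth. Every internal node has two or three children: a left and a right child, whose rectangles have half the width of the parent's and lie side by side, and possibly a third (upper) child of the same width lying on top of one of them; the children's rectangles partition the parent's rectangle. A leaf is full if and only if its rectangle contains a point of $P$ (each leaf rectangle contains at most one point of $P$). An internal node is full if and only if it has two full children; if an internal node has three children, at least one of them is full. Open rectangles are never full. -}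

module Defs where

open import Data.Nat using (ℕ; zero; suc; _^_; _≥_)
open import Data.Integer using (ℤ; +_; _+_; _<_; _≤_)
open import Data.Maybe using (Maybe; just; nothing)
open import Data.Product using (_×_; _,_; ∃; ∃-syntax; Σ)
open import Data.Sum using (_⊎_)
open import Data.Unit using (⊤)
open import Data.Empty using (⊥)
open import Data.List using (List; length)
open import Data.List.Membership.Propositional using (_∈_)
open import Data.List.Relation.Unary.All using (All)
open import Data.List.Relation.Unary.Unique.Propositional using (Unique)
open import Relation.Nullary using (¬_)
open import Relation.Binary.PropositionalEquality using (_≡_)

-- A point of the integer grid: (x = memory address, y = time).
Point : Set
Point = ℤ × ℤ

-- Axis-parallel rectangle in Z^2.  It covers the addresses
-- xl, xl+1, ..., xl+width-1 and the times yb ≤ y, and y < t if it is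
-- closed with top t (yt = just t); yt = nothing means open (unbounded upward).
record Rect : Set where
  constructor rect
  field
    xl    : ℤ
    width : ℕ
    yb    : ℤ
    yt    : Maybe ℤ
open Rect public

BelowTop : ℤ → Maybe ℤ → Set
BelowTop y nothing  = ⊤
BelowTop y (just t) = y < t

_∈R_ : Point → Rect → Set
(x , y) ∈R r = (xl r ≤ x) × (x < xl r + + width r) × (yb r ≤ y) × BelowTop y (yt r)

IsOpen : Rect → Set
IsOpen r = yt r ≡ nothing

-- Side of the upper (third) child: on top of the left or of the right child.
data Side : Set where
  onLeft onRight : Side

-- Trees indexed by height (leaves have height 0; all leaves at the same depth).
-- node2 r L R       : two children (left, right)
-- node3 r s L R U   : three children (left, right, upper child on side s)
data STTree : ℕ → Set where
  leaf  : Rect → STTree zero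
  node2 : ∀ {h} → Rect → STTree h → STTree h → STTree (suc h)
  node3 : ∀ {h} → Rect → Side → STTree h → STTree h → STTree h → STTree (suc h)

rectOf : ∀ {h} → STTree h → Rect
rectOf (leaf r)            = r
rectOf (node2 r _ _)       = r
rectOf (node3 r _ _ _ _)   = r

Full : List Point → ∀ {h} → STTree h → Set
Full P (leaf r)             = ∃[ q ] (q ∈ P × q ∈R r)
Full P (node2 r a b)        = Full P a × Full P b
Full P (node3 r s a b c)    =
  (Full P a × Full P b) ⊎ (Full P a × Full P c) ⊎ (Full P b × Full P c)

Disjoint : Rect → Rect → Set
Disjoint r s = ∀ q → q ∈R r → q ∈R s → ⊥

_⊆R_ : Rect → Rect → Set
r ⊆R s = ∀ q → q ∈R r → q ∈R s

SideBySide : ℕ → Rect → Rect → Set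
SideBySide h a b = xl b ≡ xl a + + (2 ^ h)

OnTop : Rect → Rect → Set
OnTop c u = (xl u ≡ xl c) × (yt c ≡ just (yb u))

onSide : Side → Rect → Rect → Rect
onSide onLeft  a b = a
onSide onRight a b = b

Partition2 : Rect → Rect → Rect → Set
Partition2 r a b =
  (a ⊆R r) × (b ⊆R r) × Disjoint a b × (∀ q → q ∈R r → q ∈R a ⊎ q ∈R b)

Partition3 : Rect → Rect → Rect → Rect → Set
Partition3 r a b c =
  (a ⊆R r) × (b ⊆R r) × (c ⊆R r) ×
  Disjoint a b × Disjoint a c × Disjoint b c ×
  (∀ q → q ∈R r → q ∈R a ⊎ q ∈R b ⊎ q ∈R c)

IsSTTree : List Point → ∀ {h} → STTree h → Set
IsSTTree P (leaf r) =
  (width r ≡ 1) ×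
  (∀ p q → p ∈ P → q ∈ P → p ∈R r → q ∈R r → p ≡ q) ×
  (IsOpen r → ¬ Full P (leaf r))
IsSTTree P (node2 {h} r a b) =
  (width r ≡ 2 ^ suc h) ×
  SideBySide h (rectOf a) (rectOf b) ×
  Partition2 r (rectOf a) (rectOf b) ×
  (IsOpen r → ¬ Full P (node2 r a b)) ×
  IsSTTree P a × IsSTTree P b
IsSTTree P (node3 {h} r s a b c) =
  (width r ≡ 2 ^ suc h) ×
  SideBySide h (rectOf a) (rectOf b) ×
  OnTop (onSide s (rectOf a) (rectOf b)) (rectOf c) ×
  Partition3 r (rectOf a) (rectOf b) (rectOf c) ×
  (Full P a ⊎ Full P b ⊎ Full P c) ×
  (IsOpen r → ¬ Full P (node3 r s a b c)) ×
  IsSTTree P a × IsSTTree P b × IsSTTree P c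

data _≼_ : ∀ {h H} → STTree h → STTree H → Set where
  here    : ∀ {h} {t : STTree h} → t ≼ t
  in2ˡ    : ∀ {h H} {t : STTree h} {r} {a b : STTree H} → t ≼ a → t ≼ node2 r a b
  in2ʳ    : ∀ {h H} {t : STTree h} {r} {a b : STTree H} → t ≼ b → t ≼ node2 r a b
  in3ˡ    : ∀ {h H} {t : STTree h} {r s} {a b c : STTree H} → t ≼ a → t ≼ node3 r s a b c
  in3ʳ    : ∀ {h H} {t : STTree h} {r s} {a b c : STTree H} → t ≼ b → t ≼ node3 r s a b c
  in3ᵘ    : ∀ {h H} {t : STTree h} {r s} {a b c : STTree H} → t ≼ c → t ≼ node3 r s a b c

IntersectsAtLeast : ℕ → Rect → List Point → Set
IntersectsAtLeast n r P =
  Σ (List Point) λ Q → Unique Q × All (λ q → q ∈ P × q ∈R r) Q × length Q ≥ n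

-- A full node has two full children with disjoint rectangles inside its own,
-- so by induction on the height the witnesses of the two children (2^h each)
-- can be concatenated into 2^(h+1) distinct points of P in the node's rectangle.
module Submission where

open import Defs
open import Data.Nat using (ℕ; suc; _^_; _+_; _≥_; s≤s; z≤n)
open import Data.Nat.Properties using (+-mono-≤; +-identityʳ)
open import Data.List using (List; []; _∷_; _++_; length)
open import Data.List.Properties using (length-++)
open import Data.List.Relation.Unary.All as All using (All; []; _∷_)
open import Data.List.Relation.Unary.All.Properties as All using ()
open import Data.List.Relation.Unary.AllPairs using ([]; _∷_)
open import Data.List.Relation.Unary.Unique.Propositional.Properties as Unique using ()
open import Data.List.Membership.Propositional using (_∈_)
open import Data.Product using (_×_; _,_; proj₂)
open import Data.Sum using (inj₁; inj₂)
open import Relation.Binary.PropositionalEquality using (sym; subst)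

IsSTTree-≼ : ∀ P {h H} {t : STTree h} {T : STTree H} →
             t ≼ T → IsSTTree P T → IsSTTree P t
IsSTTree-≼ P here     w = w
IsSTTree-≼ P (in2ˡ p) (_ , _ , _ , _ , wa , _)             = IsSTTree-≼ P p wa
IsSTTree-≼ P (in2ʳ p) (_ , _ , _ , _ , _ , wb)             = IsSTTree-≼ P p wb
IsSTTree-≼ P (in3ˡ p) (_ , _ , _ , _ , _ , _ , wa , _)     = IsSTTree-≼ P p wa
IsSTTree-≼ P (in3ʳ p) (_ , _ , _ , _ , _ , _ , _ , wb , _) = IsSTTree-≼ P p wb
IsSTTree-≼ P (in3ᵘ p) (_ , _ , _ , _ , _ , _ , _ , _ , wc) = IsSTTree-≼ P p wc

IntersectsAtLeast-++ : ∀ {P m n} {r a b : Rect} → a ⊆R r → b ⊆R r → Disjoint a b →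
                       IntersectsAtLeast m a P → IntersectsAtLeast n b P →
                       IntersectsAtLeast (m + n) r P
IntersectsAtLeast-++ {r = r} a⊆r b⊆r a#b (Qa , uniqueQa , inA , m≤) (Qb , uniqueQb , inB , n≤) =
  Qa ++ Qb ,
  Unique.++⁺ uniqueQa uniqueQb
    (λ (i , j) → a#b _ (proj₂ (All.lookup inA i)) (proj₂ (All.lookup inB j))) ,
  All.++⁺ (All.map (widen a⊆r) inA) (All.map (widen b⊆r) inB) ,
  subst (_≥ _) (sym (length-++ Qa)) (+-mono-≤ m≤ n≤)
  where
  widen : ∀ {P s} → s ⊆R r → ∀ {q} → q ∈ P × q ∈R s → q ∈ P × q ∈R r
  widen s⊆r (q∈P , q∈s) = q∈P , s⊆r _ q∈s

-- 2 ^ suc h unfolds to 2 ^ h + (2 ^ h + 0).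
IntersectsAtLeast-double : ∀ {P h} {r a b : Rect} → a ⊆R r → b ⊆R r → Disjoint a b →
                           IntersectsAtLeast (2 ^ h) a P → IntersectsAtLeast (2 ^ h) b P →
                           IntersectsAtLeast (2 ^ suc h) r P
IntersectsAtLeast-double {P} {h} {r} a⊆r b⊆r a#b Ia Ib =
  subst (λ n → IntersectsAtLeast (2 ^ h + n) r P) (sym (+-identityʳ (2 ^ h)))
        (IntersectsAtLeast-++ a⊆r b⊆r a#b Ia Ib)

full⇒IntersectsAtLeast : ∀ P {h} (t : STTree h) → IsSTTree P t → Full P t →
                         IntersectsAtLeast (2 ^ h) (rectOf t) P
full⇒IntersectsAtLeast P (leaf r) _ (q , q∈P , q∈r) =
  q ∷ [] , [] ∷ [] , (q∈P , q∈r) ∷ [] , s≤s z≤n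
full⇒IntersectsAtLeast P (node2 {h} r a b) (_ , _ , (a⊆r , b⊆r , a#b , _) , _ , wa , wb) (fa , fb) =
  IntersectsAtLeast-double {h = h} a⊆r b⊆r a#b
    (full⇒IntersectsAtLeast P a wa fa) (full⇒IntersectsAtLeast P b wb fb)
full⇒IntersectsAtLeast P (node3 {h} r s a b c)
  (_ , _ , _ , (a⊆r , b⊆r , c⊆r , a#b , a#c , b#c , _) , _ , _ , wa , wb , wc) = λ where
    (inj₁ (fa , fb)) → IntersectsAtLeast-double {h = h} a⊆r b⊆r a#b
      (full⇒IntersectsAtLeast P a wa fa) (full⇒IntersectsAtLeast P b wb fb)
    (inj₂ (inj₁ (fa , fc))) → IntersectsAtLeast-double {h = h} a⊆r c⊆r a#c
      (full⇒IntersectsAtLeast P a wa fa) (full⇒IntersectsAtLeast P c wc fc)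
    (inj₂ (inj₂ (fb , fc))) → IntersectsAtLeast-double {h = h} b⊆r c⊆r b#c
      (full⇒IntersectsAtLeast P b wb fb) (full⇒IntersectsAtLeast P c wc fc)

lemma1 : (P : List Point) (H : ℕ) (T : STTree H) → IsSTTree P T →
         (h : ℕ) (t : STTree h) → t ≼ T → Full P t →
         IntersectsAtLeast (2 ^ h) (rectOf t) P
lemma1 P H T wfT h t t≼T full = full⇒IntersectsAtLeast P t (IsSTTree-≼ P t≼T wfT) full
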